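{- Let $\ell\ge 1$ and define recursively $(a_0,b_0)=(\ell+1,2\ell+2)$ and, for $n\ge 1$, $a_n=\mathrm{mex}(\{a_i,b_i: i<n\}\cup\{0,1,\dots,\ell\})$, $b_n=a_n+n+\ell+1$. Then there exists a bounded function $\lambda_\ell:\mathbb{N}\to\mathbb{Z}$ such that, for all $n\ge 0$, \[ a_n=\lfloor (n+\ell)\phi\rfloor+\lambda_\ell(n); \] in particular $b_n=\lfloor (n+\ell)\phi^2\rfloor+\lambda_\ell(n)+1$.
   Context: $\phi=(1+\sqrt5)/2$ and $\mathrm{mex}\,S=\min(\mathbb{N}\setminus S)$. -}

module Defs where

open import Data.Nat as ℕ using (ℕ; zero; suc)
open import Data.Bool using (Bool; true; false; if_then_else_)
open import Data.List using (List; []; _∷_; _++_; length; upTo; concatMap)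
open import Data.Product using (_×_; _,_; proj₁; proj₂)
open import Data.Sum using (_⊎_)
open import Data.Integer as ℤ using (ℤ; +_)
open import Relation.Nullary.Decidable using (⌊_⌋)

member : ℕ → List ℕ → Bool
member k []       = false
member k (x ∷ xs) = if ⌊ k ℕ.≟ x ⌋ then true else member k xs

mexFrom : ℕ → ℕ → List ℕ → ℕ
mexFrom zero     k xs = k
mexFrom (suc f)  k xs = if member k xs then mexFrom f (suc k) xs else k

-- mex xs = min (ℕ ∖ xs); it is at most length xs, so that much fuel suffices
mex : List ℕ → ℕ
mex xs = mexFrom (suc (length xs)) 0 xs

flatten : List (ℕ × ℕ) → List ℕ
flatten = concatMap (λ p → proj₁ p ∷ proj₂ p ∷ [])

-- step ℓ n h : the pair (a_n , b_n), given h = [(a_0,b_0),…,(a_{n-1},b_{n-1})]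
step : ℕ → ℕ → List (ℕ × ℕ) → ℕ × ℕ
step ℓ zero    h = (suc ℓ , 2 ℕ.* suc ℓ)
step ℓ (suc n) h =
  let a = mex (flatten h ++ upTo (suc ℓ))
  in (a , a ℕ.+ suc n ℕ.+ ℓ ℕ.+ 1)

history : ℕ → ℕ → List (ℕ × ℕ)
history ℓ zero    = []
history ℓ (suc n) = history ℓ n ++ (step ℓ n (history ℓ n) ∷ [])

seqA : ℕ → ℕ → ℕ
seqA ℓ n = proj₁ (step ℓ n (history ℓ n))

seqB : ℕ → ℕ → ℕ
seqB ℓ n = proj₂ (step ℓ n (history ℓ n))

-- √5-le x q  means  x ≤ q√5
√5-le : ℤ → ℕ → Set
√5-le x q = (x ℤ.≤ + 0) ⊎ (x ℤ.* x ℤ.≤ + (5 ℕ.* q ℕ.* q))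

-- √5-lt q y  means  q√5 < y
√5-lt : ℕ → ℤ → Set
√5-lt q y = (+ 0 ℤ.≤ y) × (+ (5 ℕ.* q ℕ.* q) ℤ.< y ℤ.* y)

-- IsFloorHalf p q k : k = ⌊ (p + q√5) / 2 ⌋, i.e. k ≤ (p + q√5)/2 < k + 1
IsFloorHalf : ℤ → ℕ → ℤ → Set
IsFloorHalf p q k =
  (√5-le (+ 2 ℤ.* k ℤ.- p) q) × (√5-lt q (+ 2 ℤ.* k ℤ.+ + 2 ℤ.- p))

-- k = ⌊ m φ ⌋        (m φ  = (m + m√5)/2)
IsFloorφ : ℕ → ℤ → Set
IsFloorφ m k = IsFloorHalf (+ m) m k

-- k = ⌊ m φ² ⌋       (m φ² = (3m + m√5)/2)
IsFloorφ² : ℕ → ℤ → Set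
IsFloorφ² m k = IsFloorHalf (+ (3 ℕ.* m)) m k

{-# OPTIONS --safe #-}

-- The pairs (a n , b n) split {ℓ + 1, ℓ + 2, …} into two increasing sequences, so
-- a n = n + ℓ + 1 + j, where b 0, …, b (j − 1) are the b-values below a n and a n < b j.
-- Write m = n + ℓ and ⌊mφ⌋ = m + ⌊m/φ⌋. If a n exceeded ⌊mφ⌋ by more than M = 11 + 7ℓ,
-- then j would exceed ⌊m/φ⌋ by about M, and since b i = a i + i + ℓ + 1, the last b i
-- below a n would force a i far below ⌊(i + ℓ)φ⌋: ⌊·φ⌋ grows with slope φ > 4/3, and
-- ⌊⌊m/φ⌋φ⌋ ≤ m ≤ ⌊(⌊m/φ⌋ + 1)φ⌋. Symmetrically, a deficit at n forces an excess at j
-- through a n < b j. Strong induction on n therefore bounds both at once.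

module Submission where

open import Defs
open import Data.Nat using (ℕ; _≤_; _+_)
open import Data.Integer using (ℤ; +_; _-_; ∣_∣)
open import Data.Product using (Σ; ∃; _×_)

open import Data.Bool using (true; false)
open import Data.Empty using (⊥)
open import Data.List using (List; []; _∷_; _++_; length; upTo)
open import Data.List.Membership.Propositional using (_∈_; _∉_)
open import Data.List.Membership.Propositional.Properties
  using (∈-∃++; ∈-++⁻; ∈-++⁺ˡ; ∈-++⁺ʳ; ∈-upTo⁺; ∈-upTo⁻)
open import Data.List.Properties using (length-++-sucʳ; concatMap-++)
open import Data.List.Relation.Unary.Any using (here; there)
open import Data.Nat using (zero; suc; _*_; _<_; _∸_; z≤n; s≤s; s≤s⁻¹; _≟_; _≤?_; _<?_)
open import Data.Nat.Properties
open import Data.Nat.Induction using (<-rec)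
open import Data.Nat.Tactic.RingSolver using (solve)
open import Data.Integer using (_⊖_)
import Data.Integer as ℤ
import Data.Integer.Properties as ℤₚ
import Data.Integer.Tactic.RingSolver as ℤ-Solver
open import Data.Product using (_,_; proj₁; proj₂; map₁; map₂)
open import Data.Sum using (_⊎_; inj₁; inj₂; [_,_]′)
open import Function using (_∘_; _⇔_; mk⇔; Equivalence)
open import Relation.Binary.Definitions using (tri<; tri≈; tri>)
open import Relation.Binary.PropositionalEquality
  using (_≡_; _≢_; refl; sym; trans; cong; cong₂; subst; subst₂; module ≡-Reasoning)
open import Relation.Nullary using (¬_; Dec; yes; no; contradiction)

-- Linear arithmetic is done by certificates: a nonnegative combination of hypotheses
-- (built with _⊕_ and _⊗_) whose left side exceeds its right side by a ring identity.
-- It is opaque: Agda's injectivity analysis would otherwise evaluate the ring-solver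
-- proofs, which takes minutes.
opaque
  infeasible : ∀ {x y} → x ≤ y → ∀ k → x ≡ y + suc k → ⊥
  infeasible {y = y} x≤y k refl = m+1+n≰m y x≤y

infixl 6 _⊕_
infixr 7 _⊗_

_⊕_ : ∀ {x y u v} → x ≤ y → u ≤ v → x + u ≤ y + v
_⊕_ = +-mono-≤

_⊗_ : ∀ c {x y} → x ≤ y → c * x ≤ c * y
c ⊗ x≤y = *-monoʳ-≤ c x≤y

-- ≮⇒≥, stated so that the goal fixes x and y before the ring solver runs inside
≤-by-contradiction : ∀ {x y} → (y < x → ⊥) → x ≤ y
≤-by-contradiction = ≮⇒≥

member⇒∈ : ∀ {k} xs → member k xs ≡ true → k ∈ xs
member⇒∈ {k} (x ∷ xs) eq with k ≟ x
... | yes k≡x = here k≡x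
... | no  _   = there (member⇒∈ xs eq)

∈⇒member : ∀ {k xs} → k ∈ xs → member k xs ≡ true
∈⇒member {k} {x ∷ xs} k∈ with k ≟ x
... | yes _ = refl
∈⇒member {k} {x ∷ xs} (here k≡x)   | no k≢x = contradiction k≡x k≢x
∈⇒member {k} {x ∷ xs} (there k∈xs) | no _   = ∈⇒member k∈xs

range⊆⇒≤length : ∀ {k xs} → (∀ {w} → w < k → w ∈ xs) → k ≤ length xs
range⊆⇒≤length {zero}  _ = z≤n
range⊆⇒≤length {suc k} range⊆xs with ∈-∃++ (range⊆xs (n<1+n k))
... | ys , zs , refl =
  subst (suc k ≤_) (sym (length-++-sucʳ ys k zs)) (s≤s (range⊆⇒≤length range⊆ys++zs))
  where
    range⊆ys++zs : ∀ {w} → w < k → w ∈ ys ++ zs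
    range⊆ys++zs w<k with ∈-++⁻ ys (range⊆xs (m<n⇒m<1+n w<k))
    ... | inj₁ w∈ys         = ∈-++⁺ˡ w∈ys
    ... | inj₂ (here w≡k)   = contradiction w<k (<-irrefl w≡k)
    ... | inj₂ (there w∈zs) = ∈-++⁺ʳ ys w∈zs

module _ {xs : List ℕ} where

  private
    extend : ∀ {k} → (∀ {w} → w < k → w ∈ xs) → k ∈ xs → ∀ {w} → w < suc k → w ∈ xs
    extend range⊆xs k∈xs w<1+k with m<1+n⇒m<n∨m≡n w<1+k
    ... | inj₁ w<k  = range⊆xs w<k
    ... | inj₂ refl = k∈xs

  mexFrom-minimal : ∀ f {k} → (∀ {w} → w < k → w ∈ xs) → ∀ {w} → w < mexFrom f k xs → w ∈ xs
  mexFrom-minimal zero        range⊆xs = range⊆xs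
  mexFrom-minimal (suc f) {k} range⊆xs with member k xs in eq
  ... | true  = mexFrom-minimal f (extend range⊆xs (member⇒∈ xs eq))
  ... | false = range⊆xs

  mexFrom-∉ : ∀ f {k} → (∀ {w} → w < k → w ∈ xs) → length xs < f + k → mexFrom f k xs ∉ xs
  mexFrom-∉ zero        range⊆xs len<k = λ _ → <⇒≱ len<k (range⊆⇒≤length range⊆xs)
  mexFrom-∉ (suc f) {k} range⊆xs len< with member k xs in eq
  ... | true  = mexFrom-∉ f (extend range⊆xs (member⇒∈ xs eq)) (subst (length xs <_) (sym (+-suc f k)) len<)
  ... | false = λ k∈xs → contradiction (trans (sym (∈⇒member k∈xs)) eq) λ ()

mex-minimal : ∀ xs {w} → w < mex xs → w ∈ xs
mex-minimal xs = mexFrom-minimal (suc (length xs)) (λ ())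

mex-∉ : ∀ xs → mex xs ∉ xs
mex-∉ xs = mexFrom-∉ (suc (length xs)) (λ ()) (m≤m+n (suc (length xs)) 0)

-- Partitions of {ℓ + 1, ℓ + 2, …} into two increasing sequences

Increasing : (ℕ → ℕ) → Set
Increasing s = ∀ n → s n < s (suc n)

module _ {s : ℕ → ℕ} (s↑ : Increasing s) where

  increasing⇒mono-< : ∀ {i k} → i < k → s i < s k
  increasing⇒mono-< {i} {suc k} i<1+k with m<1+n⇒m<n∨m≡n i<1+k
  ... | inj₁ i<k  = <-trans (increasing⇒mono-< i<k) (s↑ k)
  ... | inj₂ refl = s↑ k

  increasing⇒mono-≤ : ∀ {i k} → i ≤ k → s i ≤ s k
  increasing⇒mono-≤ i≤k with m≤n⇒m<n∨m≡n i≤k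
  ... | inj₁ i<k  = <⇒≤ (increasing⇒mono-< i<k)
  ... | inj₂ refl = ≤-refl

  increasing⇒cancel-< : ∀ {i k} → s i < s k → i < k
  increasing⇒cancel-< si<sk = ≰⇒> λ k≤i → <⇒≱ si<sk (increasing⇒mono-≤ k≤i)

  increasing⇒n≤s[n] : ∀ n → n ≤ s n
  increasing⇒n≤s[n] zero    = z≤n
  increasing⇒n≤s[n] (suc n) = ≤-<-trans (increasing⇒n≤s[n] n) (s↑ n)

record CountBelow (s : ℕ → ℕ) (x p : ℕ) : Set where
  field
    below : ∀ {i} → i < p → s i < x
    above : x ≤ s p

open CountBelow

module _ {s : ℕ → ℕ} (s↑ : Increasing s) where

  countBelow-index : ∀ {x p i} → CountBelow s x p → x ≡ s i → i ≡ p
  countBelow-index {p = p} {i} c refl with <-cmp i p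
  ... | tri< i<p _ _ = contradiction (below c i<p) (<-irrefl refl)
  ... | tri≈ _ i≡p _ = i≡p
  ... | tri> _ _ p<i = contradiction (above c) (<⇒≱ (increasing⇒mono-< s↑ p<i))

  countBelow-hit : ∀ {x p} → CountBelow s x p → x ≡ s p → CountBelow s (suc x) (suc p)
  countBelow-hit {p = p} c x≡sp = record
    { below = λ i<1+p → [ m<n⇒m<1+n ∘ below c , (λ { refl → s≤s (≤-reflexive (sym x≡sp)) }) ]′
                              (m<1+n⇒m<n∨m≡n i<1+p)
    ; above = subst (_< s (suc p)) (sym x≡sp) (s↑ p)
    }

countBelow-miss : ∀ {s x p} → CountBelow s x p → x ≢ s p → CountBelow s (suc x) p
countBelow-miss c x≢sp = record { below = m<n⇒m<1+n ∘ below c ; above = ≤∧≢⇒< (above c) x≢sp }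

record Partition (ℓ : ℕ) (a b : ℕ → ℕ) : Set where
  field
    a-increasing : Increasing a
    b-increasing : Increasing b
    ℓ<a₀         : ℓ < a 0
    ℓ<b₀         : ℓ < b 0
    a≢b          : ∀ i j → a i ≢ b j
    covered      : ∀ {x} → ℓ < x → ∃ λ i → x ≡ a i ⊎ x ≡ b i

module Rank {ℓ : ℕ} {a b : ℕ → ℕ} (P : Partition ℓ a b) where
  open Partition P

  record Cut (x : ℕ) : Set where
    field
      p q     : ℕ
      size    : x ≡ suc (p + ℓ + q)
      a-count : CountBelow a x p
      b-count : CountBelow b x q

  cut : ∀ d → Cut (d + suc ℓ)
  cut zero = record
    { p = 0 ; q = 0 ; size = cong suc (sym (+-identityʳ ℓ))
    ; a-count = record { below = λ () ; above = ℓ<a₀ }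
    ; b-count = record { below = λ () ; above = ℓ<b₀ }
    }
  cut (suc d) with cut d | covered (m≤n+m (suc ℓ) d)
  ... | c | i , inj₁ x≡ai = record
    { p = suc p ; q = q ; size = cong suc size
    ; a-count = countBelow-hit a-increasing a-count x≡ap
    ; b-count = countBelow-miss b-count (a≢b p q ∘ trans (sym x≡ap))
    }
    where
      open Cut c
      x≡ap = trans x≡ai (cong a (countBelow-index a-increasing a-count x≡ai))
  ... | c | i , inj₂ x≡bi = record
    { p = p ; q = suc q ; size = trans (cong suc size) (cong suc (sym (+-suc (p + ℓ) q)))
    ; a-count = countBelow-miss a-count (λ x≡ap → a≢b p q (trans (sym x≡ap) x≡bq))
    ; b-count = countBelow-hit b-increasing b-count x≡bq
    }
    where
      open Cut c
      x≡bq = trans x≡bi (cong b (countBelow-index b-increasing b-count x≡bi))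

  record Position (n : ℕ) : Set where
    constructor mkPosition
    field
      j       : ℕ
      a≡      : a n ≡ suc (n + ℓ + j)
      b-below : ∀ {i} → i < j → b i < a n
      b-above : a n < b j

  position : ∀ n → Position n
  position n = mkPosition q (trans size (cong (λ p → suc (p + ℓ + q)) p≡n))
                          (below b-count) (≤∧≢⇒< (above b-count) (a≢b n q))
    where
      ℓ<aₙ : ℓ < a n
      ℓ<aₙ = <-≤-trans ℓ<a₀ (increasing⇒mono-≤ a-increasing z≤n)
      open Cut (subst Cut (m∸n+n≡m ℓ<aₙ) (cut (a n ∸ suc ℓ)))
      p≡n : p ≡ n
      p≡n = sym (countBelow-index a-increasing a-count refl)

-- The golden ratio in integer arithmetic

boundary : ∀ {p} {P : ℕ → Set p} → (∀ k → Dec (P k)) → ∀ B → P 0 → ¬ P B → ∃ λ k → P k × ¬ P (suc k)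
boundary P? zero    P0 ¬PB = contradiction P0 ¬PB
boundary P? (suc B) P0 ¬P1+B with P? B
... | yes PB  = B , PB , ¬P1+B
... | no  ¬PB = boundary P? B P0 ¬PB

infix 4 _≤[φ]_

-- k ≤[φ] m  iff  k ≤ m φ, since φ is the positive root of x² = x + 1
_≤[φ]_ : ℕ → ℕ → Set
k ≤[φ] m = k * k ≤ k * m + m * m

_≤[φ]?_ : ∀ k m → Dec (k ≤[φ] m)
k ≤[φ]? m = k * k ≤? k * m + m * m

≤[φ]-refl : ∀ m → m ≤[φ] m
≤[φ]-refl m = m≤m+n (m * m) (m * m)

≤[φ]-pred : ∀ {k m} → suc k ≤[φ] m → k ≤[φ] m
≤[φ]-pred {k} {m} h with k ≤? m
... | yes k≤m = ≤-trans (*-monoʳ-≤ k k≤m) (m≤m+n (k * m) (m * m))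
... | no  k≰m = ≤-by-contradiction λ h' → infeasible (h' ⊕ h ⊕ ≰⇒> k≰m) (k + 2) (solve (k ∷ m ∷ []))

≤[φ]-downward : ∀ {k k' m} → k ≤ k' → k' ≤[φ] m → k ≤[φ] m
≤[φ]-downward {k' = zero}   z≤n h = h
≤[φ]-downward {k' = suc k'} k≤1+k' h with m≤n⇒m<n∨m≡n k≤1+k'
... | inj₁ k<1+k' = ≤[φ]-downward (s≤s⁻¹ k<1+k') (≤[φ]-pred {k'} h)
... | inj₂ refl   = h

2m+1≰[φ]m : ∀ m → ¬ (suc (2 * m) ≤[φ] m)
2m+1≰[φ]m m h = infeasible h (m * m + 3 * m) (solve (m ∷ []))

≤[φ]-suc : ∀ {k m} → k ≤[φ] m → k ≤ 2 * m → suc k ≤[φ] suc m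
≤[φ]-suc {k} {m} h k≤2m = ≤-by-contradiction λ h' → infeasible (h' ⊕ h ⊕ k≤2m) (m + 1) (solve (k ∷ m ∷ []))

≤[φ]-3+ : ∀ {k m} → k ≤[φ] m → k ≤ 2 * m → 4 + k ≤[φ] 3 + m
≤[φ]-3+ {k} {m} h k≤2m = ≤-by-contradiction λ h' → infeasible (h' ⊕ h ⊕ 5 ⊗ k≤2m) 5 (solve (k ∷ m ∷ []))

golden-boundary : ∀ m → ∃ λ k → k ≤[φ] m × ¬ (suc k ≤[φ] m)
golden-boundary m = boundary (_≤[φ]? m) (suc (2 * m)) z≤n (2m+1≰[φ]m m)

opaque
  ⌊_·φ⌋ : ℕ → ℕ
  ⌊ m ·φ⌋ = proj₁ (golden-boundary m)

  ⌊m·φ⌋≤[φ]m : ∀ m → ⌊ m ·φ⌋ ≤[φ] m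
  ⌊m·φ⌋≤[φ]m m = proj₁ (proj₂ (golden-boundary m))

  1+⌊m·φ⌋≰[φ]m : ∀ m → ¬ (suc ⌊ m ·φ⌋ ≤[φ] m)
  1+⌊m·φ⌋≰[φ]m m = proj₂ (proj₂ (golden-boundary m))

≤[φ]⇒≤⌊·φ⌋ : ∀ {k m} → k ≤[φ] m → k ≤ ⌊ m ·φ⌋
≤[φ]⇒≤⌊·φ⌋ {k} {m} h = ≮⇒≥ λ F<k → 1+⌊m·φ⌋≰[φ]m m (≤[φ]-downward {k' = k} F<k h)

m≤⌊m·φ⌋ : ∀ m → m ≤ ⌊ m ·φ⌋
m≤⌊m·φ⌋ m = ≤[φ]⇒≤⌊·φ⌋ (≤[φ]-refl m)

⌊m·φ⌋≤2m : ∀ m → ⌊ m ·φ⌋ ≤ 2 * m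
⌊m·φ⌋≤2m m = ≮⇒≥ λ 2m<F → 2m+1≰[φ]m m (≤[φ]-downward {k' = ⌊ m ·φ⌋} 2m<F (⌊m·φ⌋≤[φ]m m))

⌊·φ⌋-step₁ : ∀ m → suc ⌊ m ·φ⌋ ≤ ⌊ suc m ·φ⌋
⌊·φ⌋-step₁ m = ≤[φ]⇒≤⌊·φ⌋ {m = suc m} (≤[φ]-suc {⌊ m ·φ⌋} (⌊m·φ⌋≤[φ]m m) (⌊m·φ⌋≤2m m))

⌊·φ⌋-step₃ : ∀ m → 4 + ⌊ m ·φ⌋ ≤ ⌊ 3 + m ·φ⌋
⌊·φ⌋-step₃ m = ≤[φ]⇒≤⌊·φ⌋ {m = 3 + m} (≤[φ]-3+ {⌊ m ·φ⌋} (⌊m·φ⌋≤[φ]m m) (⌊m·φ⌋≤2m m))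

module _ {g : ℕ → ℕ} (step₁ : ∀ k → suc (g k) ≤ g (suc k)) (step₃ : ∀ k → 4 + g k ≤ g (3 + k)) where

  private
    slope : ∀ t k → 3 * g k + 4 * t ≤ 3 * g (t + k) + 2
    slope 0 k = +-monoʳ-≤ (3 * g k) z≤n
    slope 1 k = one-step (g k) (g (suc k)) (step₁ k)
      where
        one-step : ∀ x y → suc x ≤ y → 3 * x + 4 ≤ 3 * y + 2
        one-step x y h = ≤-by-contradiction λ h' → infeasible (h' ⊕ 3 ⊗ h) 1 (solve (x ∷ y ∷ []))
    slope 2 k = two-steps (g k) (g (1 + k)) (g (2 + k)) (step₁ k) (step₁ (suc k))
      where
        two-steps : ∀ x y z → suc x ≤ y → suc y ≤ z → 3 * x + 8 ≤ 3 * z + 2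
        two-steps x y z h₁ h₂ = ≤-by-contradiction λ h' →
          infeasible (h' ⊕ 3 ⊗ h₁ ⊕ 3 ⊗ h₂) 0 (solve (x ∷ y ∷ z ∷ []))
    slope (suc (suc (suc t))) k = three-more-steps (g k) (g (t + k)) (g (3 + t + k)) (slope t k) (step₃ (t + k))
      where
        three-more-steps : ∀ x y z → 3 * x + 4 * t ≤ 3 * y + 2 → 4 + y ≤ z → 3 * x + 4 * (3 + t) ≤ 3 * z + 2
        three-more-steps x y z h₁ h₂ = ≤-by-contradiction λ h' →
          infeasible (h' ⊕ h₁ ⊕ 3 ⊗ h₂) 0 (solve (x ∷ y ∷ z ∷ t ∷ []))

  slope-4/3 : ∀ {k k'} → k ≤ k' → 3 * g k + 4 * k' ≤ 3 * g k' + 4 * k + 2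
  slope-4/3 {k} {k'} k≤k' = subst (λ k' → 3 * g k + 4 * k' ≤ 3 * g k' + 4 * k + 2) (m∸n+n≡m k≤k')
                              (shift (g k) (g (k' ∸ k + k)) (k' ∸ k) (slope (k' ∸ k) k))
    where
      shift : ∀ x y t → 3 * x + 4 * t ≤ 3 * y + 2 → 3 * x + 4 * (t + k) ≤ 3 * y + 4 * k + 2
      shift x y t h = ≤-by-contradiction λ h' → infeasible (h' ⊕ h) 0 (solve (x ∷ y ∷ t ∷ k ∷ []))

⌊·φ⌋-growth : ∀ {k k'} → k ≤ k' → 3 * ⌊ k ·φ⌋ + 4 * k' ≤ 3 * ⌊ k' ·φ⌋ + 4 * k + 2
⌊·φ⌋-growth = slope-4/3 ⌊·φ⌋-step₁ ⌊·φ⌋-step₃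

-- ⌊ m/φ ⌋ = ⌊ m φ ⌋ − m, as 1/φ = φ − 1
⌊_/φ⌋ : ℕ → ℕ
⌊ m /φ⌋ = ⌊ m ·φ⌋ ∸ m

⌊m·φ⌋≡m+⌊m/φ⌋ : ∀ m → ⌊ m ·φ⌋ ≡ m + ⌊ m /φ⌋
⌊m·φ⌋≡m+⌊m/φ⌋ m = sym (m+[n∸m]≡n (m≤⌊m·φ⌋ m))

⌊m/φ⌋≤m : ∀ m → ⌊ m /φ⌋ ≤ m
⌊m/φ⌋≤m m = ≤-trans (m≤n+o⇒m∸n≤o ⌊ m ·φ⌋ m (⌊m·φ⌋≤2m m)) (≤-reflexive (+-identityʳ m))

-- m + j ≤[φ] m  iff  j ≤ m/φ
≤[φ]-transpose : ∀ {m j k} → m + j ≤[φ] m → j ≤ m → k ≤[φ] j → k ≤ m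
≤[φ]-transpose {m} {j} {k} h j≤m k≤[φ]j = ≤-by-contradiction λ m<k →
  infeasible (≤[φ]-downward {k' = k} m<k k≤[φ]j ⊕ h ⊕ j≤m) m (solve (m ∷ j ∷ []))

≰[φ]-transpose : ∀ {m j} → ¬ (m + j ≤[φ] m) → m ≤[φ] j
≰[φ]-transpose {m} {j} h = ≤-by-contradiction λ h' → infeasible (h' ⊕ ≰⇒> h) 1 (solve (m ∷ j ∷ []))

⌊⌊m/φ⌋·φ⌋≤m : ∀ m → ⌊ ⌊ m /φ⌋ ·φ⌋ ≤ m
⌊⌊m/φ⌋·φ⌋≤m m = ≤[φ]-transpose (subst (_≤[φ] m) (⌊m·φ⌋≡m+⌊m/φ⌋ m) (⌊m·φ⌋≤[φ]m m))
                                (⌊m/φ⌋≤m m) (⌊m·φ⌋≤[φ]m ⌊ m /φ⌋)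

m≤⌊[1+⌊m/φ⌋]·φ⌋ : ∀ m → m ≤ ⌊ suc ⌊ m /φ⌋ ·φ⌋
m≤⌊[1+⌊m/φ⌋]·φ⌋ m = ≤[φ]⇒≤⌊·φ⌋ {m = suc ⌊ m /φ⌋}
  (≰[φ]-transpose {m} (subst (λ k → ¬ (k ≤[φ] m)) 1+⌊m·φ⌋≡m+[1+⌊m/φ⌋] (1+⌊m·φ⌋≰[φ]m m)))
  where
    1+⌊m·φ⌋≡m+[1+⌊m/φ⌋] : suc ⌊ m ·φ⌋ ≡ m + suc ⌊ m /φ⌋
    1+⌊m·φ⌋≡m+[1+⌊m/φ⌋] = trans (cong suc (⌊m·φ⌋≡m+⌊m/φ⌋ m)) (sym (+-suc m ⌊ m /φ⌋))

-- With 2k = m + d, the inequality k ≤ m φ = (m + m √5)/2 reads d ≤ m √5.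
≤[φ]⇔ : ∀ {k m d} → m + d ≡ 2 * k → (k ≤[φ] m ⇔ d * d ≤ 5 * m * m)
≤[φ]⇔ {k} {m} {d} m+d≡2k = mk⇔
  (λ h → +-cancelʳ-≤ (m * m + 2 * m * d) _ _ (subst₂ _≤_ 4k² 4[km+m²] (4 ⊗ h)))
  (λ h → *-cancelˡ-≤ 4 (subst₂ _≤_ (sym 4k²) (sym 4[km+m²]) (+-monoˡ-≤ (m * m + 2 * m * d) h)))
  where
    open ≡-Reasoning
    4k² : 4 * (k * k) ≡ d * d + (m * m + 2 * m * d)
    4k² = begin
      4 * (k * k)                  ≡⟨ solve (k ∷ []) ⟩
      (2 * k) * (2 * k)            ≡⟨ cong (λ x → x * x) m+d≡2k ⟨
      (m + d) * (m + d)            ≡⟨ solve (m ∷ d ∷ []) ⟩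
      d * d + (m * m + 2 * m * d)  ∎
    4[km+m²] : 4 * (k * m + m * m) ≡ 5 * m * m + (m * m + 2 * m * d)
    4[km+m²] = begin
      4 * (k * m + m * m)                ≡⟨ solve (k ∷ m ∷ []) ⟩
      2 * (2 * k) * m + 4 * (m * m)      ≡⟨ cong (λ x → 2 * x * m + 4 * (m * m)) m+d≡2k ⟨
      2 * (m + d) * m + 4 * (m * m)      ≡⟨ solve (m ∷ d ∷ []) ⟩
      5 * m * m + (m * m + 2 * m * d)    ∎

isFloorHalf : ∀ {p q k d} → p + d ≡ 2 * k → d * d ≤ 5 * q * q → 5 * q * q < (d + 2) * (d + 2) →
              IsFloorHalf (+ p) q (+ k)
isFloorHalf {p} {q} {k} {d} p+d≡2k d²≤5q² 5q²<[d+2]² =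
  subst (λ x → √5-le x q) (sym 2k-p≡d)
        (inj₂ (subst (ℤ._≤ + (5 * q * q)) (ℤₚ.pos-* d d) (ℤ.+≤+ d²≤5q²))) ,
  subst (√5-lt q) (sym 2k+2-p≡d+2)
        (ℤ.+≤+ z≤n , subst (+ (5 * q * q) ℤ.<_) (ℤₚ.pos-* (d + 2) (d + 2)) (ℤ.+<+ 5q²<[d+2]²))
  where
    2k≡p+d : + 2 ℤ.* + k ≡ + p ℤ.+ + d
    2k≡p+d = trans (sym (ℤₚ.pos-* 2 k)) (trans (cong +_ (sym p+d≡2k)) (ℤₚ.pos-+ p d))
    2k-p≡d : + 2 ℤ.* + k ℤ.- + p ≡ + d
    2k-p≡d = trans (cong (ℤ._- + p) 2k≡p+d) (cancel (+ p) (+ d))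
      where
        cancel : ∀ x y → x ℤ.+ y ℤ.- x ≡ y
        cancel = ℤ-Solver.solve-∀
    2k+2-p≡d+2 : + 2 ℤ.* + k ℤ.+ + 2 ℤ.- + p ≡ + (d + 2)
    2k+2-p≡d+2 = trans (cong (λ x → x ℤ.+ + 2 ℤ.- + p) 2k≡p+d)
                       (trans (cancel (+ p) (+ d)) (sym (ℤₚ.pos-+ d 2)))
      where
        cancel : ∀ x y → x ℤ.+ y ℤ.+ + 2 ℤ.- x ≡ y ℤ.+ + 2
        cancel = ℤ-Solver.solve-∀

golden-floors : ∀ {m k} → m ≤ k → k ≤[φ] m → ¬ (suc k ≤[φ] m) →
                IsFloorφ m (+ k) × IsFloorφ² m (+ (k + m))
golden-floors {m} {k} m≤k k≤[φ]m 1+k≰[φ]m with m≤n⇒∃[o]m+o≡n (≤-trans m≤k (m≤m+n k (k + 0)))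
... | d , m+d≡2k = isFloorHalf {m} {m} {k} m+d≡2k d²≤5m² 5m²<[d+2]²
                 , isFloorHalf {3 * m} {m} {k + m} 3m+d≡2[k+m] d²≤5m² 5m²<[d+2]²
  where
    open ≡-Reasoning
    m+[d+2]≡2[1+k] : m + (d + 2) ≡ 2 * suc k
    m+[d+2]≡2[1+k] = begin
      m + (d + 2)   ≡⟨ solve (m ∷ d ∷ []) ⟩
      (m + d) + 2   ≡⟨ cong (_+ 2) m+d≡2k ⟩
      2 * k + 2     ≡⟨ solve (k ∷ []) ⟩
      2 * suc k     ∎
    3m+d≡2[k+m] : 3 * m + d ≡ 2 * (k + m)
    3m+d≡2[k+m] = begin
      3 * m + d          ≡⟨ solve (m ∷ d ∷ []) ⟩
      2 * m + (m + d)    ≡⟨ cong (λ x → 2 * m + x) m+d≡2k ⟩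
      2 * m + 2 * k      ≡⟨ solve (m ∷ k ∷ []) ⟩
      2 * (k + m)        ∎
    d²≤5m² : d * d ≤ 5 * m * m
    d²≤5m² = Equivalence.to (≤[φ]⇔ {k} {m} {d} m+d≡2k) k≤[φ]m
    5m²<[d+2]² : 5 * m * m < (d + 2) * (d + 2)
    5m²<[d+2]² = ≰⇒> (1+k≰[φ]m ∘ Equivalence.from (≤[φ]⇔ {suc k} {m} {d + 2} m+[d+2]≡2[1+k]))

⌊·φ⌋-floors : ∀ m → IsFloorφ m (+ ⌊ m ·φ⌋) × IsFloorφ² m (+ (⌊ m ·φ⌋ + m))
⌊·φ⌋-floors m = golden-floors (m≤⌊m·φ⌋ m) (⌊m·φ⌋≤[φ]m m) (1+⌊m·φ⌋≰[φ]m m)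

-- Distance of a partition from the golden Beatty sequence

x<x+y+z+1 : ∀ x y z → x < x + y + z + 1
x<x+y+z+1 x y z = ≤-by-contradiction λ h → infeasible h (y + z) (solve (x ∷ y ∷ z ∷ []))

b-def⇒a<b : ∀ {ℓ} {a b : ℕ → ℕ} → (∀ n → b n ≡ a n + n + ℓ + 1) → ∀ n → a n < b n
b-def⇒a<b {ℓ} {a} b-def n = subst (a n <_) (sym (b-def n)) (x<x+y+z+1 (a n) n ℓ)

module Deviation {ℓ : ℕ} {a b : ℕ → ℕ} (P : Partition ℓ a b) (b-def : ∀ n → b n ≡ a n + n + ℓ + 1) where
  open Partition P
  open Rank P

  M : ℕ
  M = 11 + 7 * ℓ

  -- stated with M unfolded, since the ring solver does not look through M
  private
    upper-certificate₀ : ∀ {m J} → m + J + (11 + 7 * ℓ) < suc (m + 0) → ⊥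
    upper-certificate₀ {m} {J} h = infeasible h (J + 7 * ℓ + 10) (solve (m ∷ J ∷ ℓ ∷ []))

    upper-gap : ∀ {m J i} → m + J + (11 + 7 * ℓ) < suc (m + suc i) → suc J ≤ i + ℓ
    upper-gap {m} {J} {i} h = ≤-by-contradiction λ h' →
      infeasible (h ⊕ h') (9 + 8 * ℓ) (solve (m ∷ J ∷ i ∷ ℓ ∷ []))

    upper-certificate : ∀ {m J i aᵢ Fᵢ F'} → m + J + (11 + 7 * ℓ) < suc (m + suc i) →
                        suc (aᵢ + i + ℓ + 1) ≤ suc (m + suc i) → Fᵢ ≤ aᵢ + (11 + 7 * ℓ) → m ≤ F' →
                        3 * F' + 4 * (i + ℓ) ≤ 3 * Fᵢ + 4 * suc J + 2 → ⊥
    upper-certificate {m} {J} {i} {aᵢ} {Fᵢ} {F'} h₁ h₂ h₃ h₄ h₅ =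
      infeasible (4 ⊗ h₁ ⊕ 3 ⊗ h₂ ⊕ 3 ⊗ h₃ ⊕ 3 ⊗ h₄ ⊕ h₅) (14 * ℓ) (solve (m ∷ J ∷ i ∷ aᵢ ∷ Fᵢ ∷ F' ∷ ℓ ∷ []))

    lower-index : ∀ {n j J} → suc (n + ℓ + j) + (11 + 7 * ℓ) < n + ℓ + J → J ≤ n + ℓ → j < n
    lower-index {n} {j} {J} h J≤m = ≤-by-contradiction λ h' →
      infeasible (h ⊕ J≤m ⊕ h') (12 + 6 * ℓ) (solve (n ∷ j ∷ J ∷ ℓ ∷ []))

    lower-gap : ∀ {m j J} → suc (m + j) + (11 + 7 * ℓ) < m + J → j + ℓ ≤ J
    lower-gap {m} {j} {J} h = ≤-by-contradiction λ h' →
      infeasible (h ⊕ h') (13 + 6 * ℓ) (solve (m ∷ j ∷ J ∷ ℓ ∷ []))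

    lower-certificate : ∀ {m j J aⱼ Fⱼ F'} → suc (m + j) + (11 + 7 * ℓ) < m + J →
                        suc (m + j) < aⱼ + j + ℓ + 1 → aⱼ ≤ Fⱼ + (11 + 7 * ℓ) → F' ≤ m →
                        3 * Fⱼ + 4 * J ≤ 3 * F' + 4 * (j + ℓ) + 2 → ⊥
    lower-certificate {m} {j} {J} {aⱼ} {Fⱼ} {F'} h₁ h₂ h₃ h₄ h₅ =
      infeasible (4 ⊗ h₁ ⊕ 3 ⊗ h₂ ⊕ 3 ⊗ h₃ ⊕ 3 ⊗ h₄ ⊕ h₅) 19 (solve (m ∷ j ∷ J ∷ aⱼ ∷ Fⱼ ∷ F' ∷ ℓ ∷ []))

  upper : ∀ n → (∀ {k} → k < n → ⌊ k + ℓ ·φ⌋ ≤ a k + M) → a n ≤ ⌊ n + ℓ ·φ⌋ + M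
  upper n ih = ≤-by-contradiction λ F+M<aₙ →
    refute (position n) (subst (λ x → x + M < a n) (⌊m·φ⌋≡m+⌊m/φ⌋ m) F+M<aₙ)
    where
      m = n + ℓ
      J = ⌊ m /φ⌋
      refute : Position n → m + J + M < a n → ⊥
      refute (mkPosition zero    aₙ≡ _      _) h = upper-certificate₀ (subst (m + J + M <_) aₙ≡ h)
      refute (mkPosition (suc i) aₙ≡ b<aₙ _) h =
        upper-certificate h' (subst₂ _<_ (b-def i) aₙ≡ bᵢ<aₙ) (ih i<n)
                          (m≤⌊[1+⌊m/φ⌋]·φ⌋ m) (⌊·φ⌋-growth (upper-gap h'))
        where
          h' : m + J + M < suc (m + suc i)
          h' = subst (m + J + M <_) aₙ≡ h
          bᵢ<aₙ : b i < a n
          bᵢ<aₙ = b<aₙ (n<1+n i)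
          i<n : i < n
          i<n = increasing⇒cancel-< b-increasing (<-trans bᵢ<aₙ (b-def⇒a<b {ℓ} {a} {b} b-def n))

  lower : ∀ n → (∀ {k} → k < n → a k ≤ ⌊ k + ℓ ·φ⌋ + M) → ⌊ n + ℓ ·φ⌋ ≤ a n + M
  lower n ih = ≤-by-contradiction λ aₙ+M<F →
    refute (position n) (subst (a n + M <_) (⌊m·φ⌋≡m+⌊m/φ⌋ m) aₙ+M<F)
    where
      m = n + ℓ
      J = ⌊ m /φ⌋
      refute : Position n → a n + M < m + J → ⊥
      refute (mkPosition j aₙ≡ _ aₙ<bⱼ) h =
        lower-certificate h' (subst₂ _<_ aₙ≡ (b-def j) aₙ<bⱼ) (ih (lower-index h' (⌊m/φ⌋≤m m)))
                          (⌊⌊m/φ⌋·φ⌋≤m m) (⌊·φ⌋-growth (lower-gap h'))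
        where
          h' : suc (m + j) + M < m + J
          h' = subst (λ x → x + M < m + J) aₙ≡ h

  bounded : ∀ n → a n ≤ ⌊ n + ℓ ·φ⌋ + M × ⌊ n + ℓ ·φ⌋ ≤ a n + M
  bounded = <-rec _ λ n ih → upper n (proj₂ ∘ ih) , lower n (proj₁ ∘ ih)

module Sequence (ℓ : ℕ) where

  a b : ℕ → ℕ
  a = seqA ℓ
  b = seqB ℓ

  b-def : ∀ n → b n ≡ a n + n + ℓ + 1
  b-def zero    = begin 2 * suc ℓ ≡⟨ solve (ℓ ∷ []) ⟩ suc ℓ + 0 + ℓ + 1 ∎
    where open ≡-Reasoning
  b-def (suc n) = refl

  a<b : ∀ n → a n < b n
  a<b = b-def⇒a<b {ℓ} {a} {b} b-def

  -- seqA ℓ (suc n) is mex (excluded (suc n)) by definition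
  excluded : ℕ → List ℕ
  excluded n = flatten (history ℓ n) ++ upTo (suc ℓ)

  flatten-history-suc : ∀ n → flatten (history ℓ (suc n)) ≡ flatten (history ℓ n) ++ a n ∷ b n ∷ []
  flatten-history-suc n = concatMap-++ _ (history ℓ n) _

  ∈-history⁻ : ∀ {n x} → x ∈ flatten (history ℓ n) → ∃ λ i → i < n × (x ≡ a i ⊎ x ≡ b i)
  ∈-history⁻ {suc n} {x} x∈ with ∈-++⁻ (flatten (history ℓ n)) (subst (x ∈_) (flatten-history-suc n) x∈)
  ... | inj₁ x∈h                  = map₂ (map₁ m<n⇒m<1+n) (∈-history⁻ x∈h)
  ... | inj₂ (here x≡aₙ)         = n , n<1+n n , inj₁ x≡aₙ
  ... | inj₂ (there (here x≡bₙ)) = n , n<1+n n , inj₂ x≡bₙ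

  ∈-history⁺ : ∀ {n i x} → i < n → x ≡ a i ⊎ x ≡ b i → x ∈ flatten (history ℓ n)
  ∈-history⁺ {suc n} {i} {x} i<1+n x≡ with m<1+n⇒m<n∨m≡n i<1+n
  ... | inj₁ i<n  = subst (x ∈_) (sym (flatten-history-suc n)) (∈-++⁺ˡ (∈-history⁺ i<n x≡))
  ... | inj₂ refl = subst (x ∈_) (sym (flatten-history-suc n)) (∈-++⁺ʳ _ ([ here , there ∘ here ]′ x≡))

  ∈-excluded⁻ : ∀ {n x} → x ∈ excluded n → x ≤ ℓ ⊎ ∃ λ i → i < n × (x ≡ a i ⊎ x ≡ b i)
  ∈-excluded⁻ {n} x∈ = [ inj₂ ∘ ∈-history⁻ , inj₁ ∘ s≤s⁻¹ ∘ ∈-upTo⁻ ]′ (∈-++⁻ (flatten (history ℓ n)) x∈)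

  ≤ℓ⇒∈excluded : ∀ {n x} → x ≤ ℓ → x ∈ excluded n
  ≤ℓ⇒∈excluded {n} x≤ℓ = ∈-++⁺ʳ (flatten (history ℓ n)) (∈-upTo⁺ (s≤s x≤ℓ))

  taken⇒∈excluded : ∀ {n i x} → i < n → x ≡ a i ⊎ x ≡ b i → x ∈ excluded n
  taken⇒∈excluded i<n x≡ = ∈-++⁺ˡ (∈-history⁺ i<n x≡)

  a-∉ : ∀ n → a (suc n) ∉ excluded (suc n)
  a-∉ n = mex-∉ (excluded (suc n))

  <a⇒∈excluded : ∀ {n w} → w < a n → w ∈ excluded n
  <a⇒∈excluded {zero}  w<1+ℓ = ≤ℓ⇒∈excluded {0} (s≤s⁻¹ w<1+ℓ)
  <a⇒∈excluded {suc n}       = mex-minimal (excluded (suc n))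

  ≤a⇒∈excluded[1+] : ∀ {n w} → w ≤ a n → w ∈ excluded (suc n)
  ≤a⇒∈excluded[1+] {n} w≤aₙ with m≤n⇒m<n∨m≡n w≤aₙ
  ... | inj₂ refl = taken⇒∈excluded (n<1+n n) (inj₁ refl)
  ... | inj₁ w<aₙ with ∈-excluded⁻ {n} (<a⇒∈excluded {n} w<aₙ)
  ...   | inj₁ w≤ℓ            = ≤ℓ⇒∈excluded {suc n} w≤ℓ
  ...   | inj₂ (i , i<n , w≡) = taken⇒∈excluded {suc n} (m<n⇒m<1+n i<n) w≡

  a-increasing : Increasing a
  a-increasing n = ≰⇒> (a-∉ n ∘ ≤a⇒∈excluded[1+] {n})

  b-increasing : Increasing b
  b-increasing n = subst (_< b (suc n)) (sym (b-def n))
                         (+-monoˡ-< 1 (+-monoˡ-< ℓ (+-mono-< (a-increasing n) (n<1+n n))))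

  a≢b : ∀ n i → a n ≢ b i
  a≢b n i aₙ≡bᵢ with i <? n
  a≢b zero    i aₙ≡bᵢ | yes ()
  a≢b (suc n) i aₙ≡bᵢ | yes i<1+n = a-∉ n (taken⇒∈excluded i<1+n (inj₂ aₙ≡bᵢ))
  a≢b n       i aₙ≡bᵢ | no  i≮n   =
    <-irrefl aₙ≡bᵢ (≤-<-trans (increasing⇒mono-≤ a-increasing (≮⇒≥ i≮n)) (a<b i))

  covered : ∀ {x} → ℓ < x → ∃ λ i → x ≡ a i ⊎ x ≡ b i
  covered {x} ℓ<x with ∈-excluded⁻ {suc x} (<a⇒∈excluded {suc x} (increasing⇒n≤s[n] a-increasing (suc x)))
  ... | inj₁ x≤ℓ          = contradiction x≤ℓ (<⇒≱ ℓ<x)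
  ... | inj₂ (i , _ , x≡) = i , x≡

  partition : Partition ℓ a b
  partition = record
    { a-increasing = a-increasing
    ; b-increasing = b-increasing
    ; ℓ<a₀         = ≤-refl
    ; ℓ<b₀         = <-trans ≤-refl (a<b 0)
    ; a≢b          = a≢b
    ; covered      = covered
    }

∣⊖∣≤ : ∀ {x y d} → x ≤ y + d → y ≤ x + d → ∣ x ⊖ y ∣ ≤ d
∣⊖∣≤ {x} {y} x≤y+d y≤x+d with ≤-total x y
... | inj₁ x≤y = subst (_≤ _) (sym (ℤₚ.∣⊖∣-≤ x≤y)) (m≤n+o⇒m∸n≤o y x y≤x+d)
... | inj₂ y≤x = subst (_≤ _) (sym (trans (ℤₚ.∣m⊖n∣≡∣n⊖m∣ x y) (ℤₚ.∣⊖∣-≤ y≤x))) (m≤n+o⇒m∸n≤o x y x≤y+d)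

+x-[x⊖y]≡+y : ∀ x y → + x - (x ⊖ y) ≡ + y
+x-[x⊖y]≡+y x y = trans (cong (λ z → + x - z) (sym (ℤₚ.m-n≡m⊖n x y))) (ring (+ x) (+ y))
  where
    ring : ∀ u v → u - (u - v) ≡ v
    ring = ℤ-Solver.solve-∀

+[x+m+1]-[x⊖y]-1≡+[y+m] : ∀ x y m → + (x + m + 1) - (x ⊖ y) - + 1 ≡ + (y + m)
+[x+m+1]-[x⊖y]-1≡+[y+m] x y m = begin
  + (x + m + 1) - (x ⊖ y) - + 1               ≡⟨ cong₂ (λ u v → u - v - + 1) +[x+m+1]≡ (sym (ℤₚ.m-n≡m⊖n x y)) ⟩
  + x ℤ.+ + m ℤ.+ + 1 - (+ x - + y) - + 1     ≡⟨ ring (+ x) (+ y) (+ m) ⟩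
  + y ℤ.+ + m                                 ≡⟨ ℤₚ.pos-+ y m ⟨
  + (y + m)                                   ∎
  where
    open ≡-Reasoning
    +[x+m+1]≡ : + (x + m + 1) ≡ + x ℤ.+ + m ℤ.+ + 1
    +[x+m+1]≡ = trans (ℤₚ.pos-+ (x + m) 1) (cong (ℤ._+ + 1) (ℤₚ.pos-+ x m))
    ring : ∀ u v w → u ℤ.+ w ℤ.+ + 1 - (u - v) - + 1 ≡ v ℤ.+ w
    ring = ℤ-Solver.solve-∀

deviation : ℕ → ℕ → ℤ
deviation ℓ n = seqA ℓ n ⊖ ⌊ n + ℓ ·φ⌋

corollary19 : (ℓ : ℕ) → 1 ≤ ℓ →
    Σ (ℕ → ℤ) λ lam →
      (∃ λ B → ∀ n → ∣ lam n ∣ ≤ B) ×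
      (∀ n → IsFloorφ (n + ℓ) (+ seqA ℓ n - lam n)) ×
      (∀ n → IsFloorφ² (n + ℓ) (+ seqB ℓ n - lam n - + 1))
corollary19 ℓ _ = deviation ℓ , (M , deviation-bounded) , a-floor , b-floor
  where
    open Sequence ℓ
    open Deviation partition b-def
    deviation-bounded : ∀ n → ∣ deviation ℓ n ∣ ≤ M
    deviation-bounded n = ∣⊖∣≤ (proj₁ (bounded n)) (proj₂ (bounded n))
    a-floor : ∀ n → IsFloorφ (n + ℓ) (+ a n - deviation ℓ n)
    a-floor n = subst (IsFloorφ (n + ℓ)) (sym (+x-[x⊖y]≡+y (a n) ⌊ n + ℓ ·φ⌋))
                      (proj₁ (⌊·φ⌋-floors (n + ℓ)))
    b-floor : ∀ n → IsFloorφ² (n + ℓ) (+ b n - deviation ℓ n - + 1)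
    b-floor n = subst (IsFloorφ² (n + ℓ)) (sym b-shift) (proj₂ (⌊·φ⌋-floors (n + ℓ)))
      where
        b-shift : + b n - deviation ℓ n - + 1 ≡ + (⌊ n + ℓ ·φ⌋ + (n + ℓ))
        b-shift = trans (cong (λ x → + x - deviation ℓ n - + 1)
                              (trans (b-def n) (cong (_+ 1) (+-assoc (a n) n ℓ))))
                        (+[x+m+1]-[x⊖y]-1≡+[y+m] (a n) ⌊ n + ℓ ·φ⌋ (n + ℓ))
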